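{- The following are theorems of $\mathbf{LEL}^{[:=]}$ (for all agents $a$, variables, finite sequences of variables $\vec x$ and agents $\vec a$ of equal length, formulas $\phi$ and sentences $\alpha$): (R) $[x:=a]\phi\leftrightarrow[y:=a]\phi[y/x]$, provided $y$ does not occur in $\phi$; (KPI) $[\vec x:=\vec a](\mathsf K_{\vec x}\alpha\to\mathsf K_{\vec x}[\vec x:=\vec a]\mathsf K_{\vec x}\alpha)$; (ANI) $[x:=a](\neg p_x\to\mathsf K_x[x:=a]\neg p_x)$.
   Context: Fix a nonempty finite set $\mathbf{A}$ of agents, a countable set $\mathbf{X}$ of variables with $\mathbf A\cap\mathbf X=\emptyset$, and a countable set $\mathbf{P}$ of predicate letters. Formulas of $\mathcal{L}^{[:=]}$ and free variables: $\phi ::= p_x \mid \top \mid \neg\phi \mid (\phi\wedge\phi) \mid [x:=a]\phi \mid \mathsf{K}_X\alpha$, with $p\in\mathbf P$, $x\in\mathbf X$, $a\in\mathbf A$, $X\subseteq\mathbf X$ finite (possibly empty), $\alpha$ a formula with no free variables (a sentence); $FV(p_x)=\{x\}$, $FV(\top)=\emptyset$, $FV$ commutes with Booleans, $FV([x:=a]\phi)=FV(\phi)\setminus\{x\}$, $FV(\mathsf K_X\alpha)=X$. Other Booleans as usual, $\bot:=\neg\top$, $\langle x:=a\rangle\phi:=\neg[x:=a]\neg\phi$, $\widehat{\mathsf K}_X\alpha:=\neg\mathsf K_X\neg\alpha$. $\phi[y/x]$ replaces all free occurrences of $x$ by $y$; it is admissible if $x$ has no free occurrence within the scope of any $[y:=b]$.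 For $\vec x=x_1,\dots,x_n$, $\vec a=a_1,\dots,a_n$: $[\vec x:=\vec a]\phi$ abbreviates $[x_1:=a_1]\cdots[x_n:=a_n]\phi$ (just $\phi$ if $n=0$), $\mathsf K_{\vec x}$ abbreviates $\mathsf K_{\{x_1,\dots,x_n\}}$, and $\mathsf K_x$ abbreviates $\mathsf K_{\{x\}}$. The system $\mathbf{LEL}^{[:=]}$ has axioms: all propositional tautologies; $\mathsf K_X(\alpha\to\beta)\to(\mathsf K_X\alpha\to\mathsf K_X\beta)$; $\mathsf K_X\alpha\to\mathsf K_Y\alpha$ for $X\subseteq Y$; $[x:=a](\phi\to\psi)\to([x:=a]\phi\to[x:=a]\psi)$; $\langle x:=a\rangle\phi\to[x:=a]\phi$; $\phi\to[x:=a]\phi$ if $x\notin FV(\phi)$; $[y:=a]([x:=a]\phi\to\phi[y/x])$ if $\phi[y/x]$ is admissible; $[x:=a][y:=b]\phi\to[y:=b][x:=a]\phi$ for $x\neq y$; $\bigwedge_{a\in\mathbf A}[x:=a]\phi\to\phi$; $\mathsf K_X\alpha\to\alpha$; (KNI) $[\vec x:=\vec a](\neg\mathsf K_{\vec x}\alpha\to\mathsf K_{\vec x}[\vec x:=\vec a]\neg\mathsf K_{\vec x}\alpha)$; (EPI) $[x:=a]\mathsf K_x\langle x:=a\rangle\top$; (API) $[x:=a](p_x\to\mathsf K_x[x:=a]p_x)$; (ENI) $[\vec x:=\vec a](\bigwedge_{b\in B}[x:=b]\bot\to\mathsf K_{\vec x}\bigwedge_{b\in B}[x:=b]\bot)$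 where $B=\mathbf A\setminus\{\vec a\}$. Rules: modus ponens; from $\alpha$ infer $\mathsf K_\emptyset\alpha$ ($\alpha$ a sentence); from $\phi$ infer $[x:=a]\phi$. -}

module Defs where

open import Data.Nat using (ℕ; suc; _≡ᵇ_)
open import Data.Bool using (T?; Bool; true; false; not; _∧_; _∨_; if_then_else_)
open import Data.Fin using (Fin)
open import Data.Fin.Properties using () renaming (_≟_ to _≟F_)
open import Data.List using (List; []; _∷_; map; foldr; filter; allFin)
open import Data.List.Membership.Propositional using (_∈_)
open import Data.List.Relation.Binary.Subset.Propositional using (_⊆_)
open import Data.Product using (_×_; _,_; proj₁; proj₂)
open import Relation.Nullary using (¬_)
open import Relation.Nullary.Decidable using (isYes; ⌊_⌋)
open import Relation.Binary.PropositionalEquality using (_≡_; refl)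

Var : Set
Var = ℕ

Pred : Set
Pred = ℕ

memb : Var → List Var → Bool
memb y []       = false
memb y (z ∷ zs) = if y ≡ᵇ z then true else memb y zs

module Logic (n : ℕ) where

  Agent : Set
  Agent = Fin (suc n)

  -- Formulas of L^[:=]; K_X α is only formed for sentences α
  -- (the closedness proof is irrelevant, so it does not affect formula identity).
  data Formula : Set
  isFree : Var → Formula → Bool

  data Formula where
    P    : Pred → Var → Formula
    ⊤f   : Formula
    ¬f_  : Formula → Formula
    _∧f_ : Formula → Formula → Formula
    [_≔_]_ : Var → Agent → Formula → Formula
    𝐊    : (X : List Var) (α : Formula) → .(∀ y → isFree y α ≡ false) → Formula

  isFree y (P p x)       = y ≡ᵇ x
  isFree y ⊤f            = false
  isFree y (¬f φ)        = isFree y φ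
  isFree y (φ ∧f ψ)      = isFree y φ ∨ isFree y ψ
  isFree y ([ x ≔ a ] φ) = if y ≡ᵇ x then false else isFree y φ
  isFree y (𝐊 X α _)     = memb y X

  Closed : Formula → Set
  Closed α = ∀ y → isFree y α ≡ false

  infixr 6 _∧f_
  infixr 5 _⇒f_ _∨f_
  infix  4 _⇔f_
  infixr 7 ¬f_ [_≔_]_ ⟨_≔_⟩_

  ⊥f : Formula
  ⊥f = ¬f ⊤f

  _∨f_ : Formula → Formula → Formula
  φ ∨f ψ = ¬f (¬f φ ∧f ¬f ψ)

  _⇒f_ : Formula → Formula → Formula
  φ ⇒f ψ = ¬f (φ ∧f ¬f ψ)

  _⇔f_ : Formula → Formula → Formula
  φ ⇔f ψ = (φ ⇒f ψ) ∧f (ψ ⇒f φ)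

  ⟨_≔_⟩_ : Var → Agent → Formula → Formula
  ⟨ x ≔ a ⟩ φ = ¬f [ x ≔ a ] ¬f φ

  ⋀ : List Formula → Formula
  ⋀ = foldr _∧f_ ⊤f

  -- [x⃗ := a⃗]φ for sequences of equal length, given as a list of pairs (xᵢ , aᵢ)
  assign : List (Var × Agent) → Formula → Formula
  assign []             φ = φ
  assign ((x , a) ∷ ps) φ = [ x ≔ a ] assign ps φ

  vars : List (Var × Agent) → List Var
  vars = map proj₁

  agents : List (Var × Agent) → List Agent
  agents = map proj₂

  membA : Agent → List Agent → Bool
  membA b []       = false
  membA b (c ∷ cs) = ⌊ b ≟F c ⌋ ∨ membA b cs

  notIn : List (Var × Agent) → List Agent
  notIn ps = filter (λ b → T? (not (membA b (agents ps)))) (allFin (suc n))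

  rn : Var → Var → Var → Var
  rn y x z = if z ≡ᵇ x then y else z

  subst : Var → Var → Formula → Formula
  subst y x (P p z)       = P p (rn y x z)
  subst y x ⊤f            = ⊤f
  subst y x (¬f φ)        = ¬f subst y x φ
  subst y x (φ ∧f ψ)      = subst y x φ ∧f subst y x ψ
  subst y x ([ z ≔ a ] φ) = if z ≡ᵇ x then [ z ≔ a ] φ else [ z ≔ a ] subst y x φ
  subst y x (𝐊 X α c)     = 𝐊 (map (rn y x) X) α c

  -- φ[y/x] is admissible: x has no free occurrence (free in φ) within the scope of any [y:=b]
  admissible : Var → Var → Formula → Bool
  admissible y x (P p z)       = true
  admissible y x ⊤f            = true
  admissible y x (¬f φ)        = admissible y x φ
  admissible y x (φ ∧f ψ)      = admissible y x φ ∧ admissible y x ψ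
  admissible y x ([ z ≔ a ] φ) =
    if z ≡ᵇ x then true
    else (if z ≡ᵇ y then not (isFree x φ) else admissible y x φ)
  admissible y x (𝐊 X α c)     = true

  occurs : Var → Formula → Bool
  occurs y (P p z)       = y ≡ᵇ z
  occurs y ⊤f            = false
  occurs y (¬f φ)        = occurs y φ
  occurs y (φ ∧f ψ)      = occurs y φ ∨ occurs y ψ
  occurs y ([ z ≔ a ] φ) = (y ≡ᵇ z) ∨ occurs y φ
  occurs y (𝐊 X α c)     = memb y X ∨ occurs y α

  -- propositional tautologies (substitution instances): Boolean evaluation
  -- treating p_x, [x:=a]φ and K_X α as atoms
  eval : (Formula → Bool) → Formula → Bool
  eval v ⊤f       = true
  eval v (¬f φ)   = not (eval v φ)
  eval v (φ ∧f ψ) = eval v φ ∧ eval v ψ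
  eval v φ        = v φ

  Tautology : Formula → Set
  Tautology φ = ∀ (v : Formula → Bool) → eval v φ ≡ true

  -- Where an axiom needs K applied to a compound
  -- formula, the (always available) closedness proof of that formula is taken
  -- as an argument; this does not change the set of theorems.
  data ⊢_ : Formula → Set where
    taut  : ∀ {φ} → Tautology φ → ⊢ φ
    Kdist : ∀ X α β (cα : Closed α) (cβ : Closed β) (c : Closed (α ⇒f β)) →
            ⊢ (𝐊 X (α ⇒f β) c ⇒f (𝐊 X α cα ⇒f 𝐊 X β cβ))
    Kmono : ∀ X Y α (cα : Closed α) → X ⊆ Y → ⊢ (𝐊 X α cα ⇒f 𝐊 Y α cα)
    Adist : ∀ x a φ ψ → ⊢ ([ x ≔ a ] (φ ⇒f ψ) ⇒f ([ x ≔ a ] φ ⇒f [ x ≔ a ] ψ))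
    Afun  : ∀ x a φ → ⊢ (⟨ x ≔ a ⟩ φ ⇒f [ x ≔ a ] φ)
    Avac  : ∀ x a φ → isFree x φ ≡ false → ⊢ (φ ⇒f [ x ≔ a ] φ)
    Asub  : ∀ x y a φ → admissible y x φ ≡ true →
            ⊢ ([ y ≔ a ] ([ x ≔ a ] φ ⇒f subst y x φ))
    Acomm : ∀ x y a b φ → ¬ (x ≡ y) →
            ⊢ ([ x ≔ a ] [ y ≔ b ] φ ⇒f [ y ≔ b ] [ x ≔ a ] φ)
    Aall  : ∀ x φ → ⊢ (⋀ (map (λ a → [ x ≔ a ] φ) (allFin (suc n))) ⇒f φ)
    KT    : ∀ X α (cα : Closed α) → ⊢ (𝐊 X α cα ⇒f α)
    KNI   : ∀ ps α (cα : Closed α) (c : Closed (assign ps (¬f 𝐊 (vars ps) α cα))) →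
            ⊢ assign ps (¬f 𝐊 (vars ps) α cα ⇒f 𝐊 (vars ps) (assign ps (¬f 𝐊 (vars ps) α cα)) c)
    EPI   : ∀ x a (c : Closed (⟨ x ≔ a ⟩ ⊤f)) → ⊢ ([ x ≔ a ] 𝐊 (x ∷ []) (⟨ x ≔ a ⟩ ⊤f) c)
    API   : ∀ x a p (c : Closed ([ x ≔ a ] P p x)) →
            ⊢ ([ x ≔ a ] (P p x ⇒f 𝐊 (x ∷ []) ([ x ≔ a ] P p x) c))
    ENI   : ∀ ps x (c : Closed (⋀ (map (λ b → [ x ≔ b ] ⊥f) (notIn ps)))) →
            ⊢ assign ps (⋀ (map (λ b → [ x ≔ b ] ⊥f) (notIn ps)) ⇒f
                          𝐊 (vars ps) (⋀ (map (λ b → [ x ≔ b ] ⊥f) (notIn ps))) c)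
    MP    : ∀ {φ ψ} → ⊢ (φ ⇒f ψ) → ⊢ φ → ⊢ ψ
    Nec   : ∀ {α} (cα : Closed α) → ⊢ α → ⊢ 𝐊 [] α cα
    Gen   : ∀ {φ} x a → ⊢ φ → ⊢ ([ x ≔ a ] φ)

  private
    ifF : ∀ (b : Bool) {c} → c ≡ false → (if b then false else c) ≡ false
    ifF true  _ = refl
    ifF false e = e

    assign-bound : ∀ ps y χ → memb y (vars ps) ≡ true → isFree y (assign ps χ) ≡ false
    assign-bound [] y χ ()
    assign-bound ((z , a) ∷ ps) y χ e with y ≡ᵇ z
    ... | true  = refl
    ... | false = assign-bound ps y χ e

    assign-free : ∀ ps y χ → memb y (vars ps) ≡ false → isFree y (assign ps χ) ≡ isFree y χ
    assign-free [] y χ _ = refl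
    assign-free ((z , a) ∷ ps) y χ e with y ≡ᵇ z
    assign-free ((z , a) ∷ ps) y χ () | true
    ... | false = assign-free ps y χ e

  closed-assign-K : ∀ ps α (cα : Closed α) → Closed (assign ps (𝐊 (vars ps) α cα))
  closed-assign-K ps α cα y with memb y (vars ps) in e
  ... | true  = assign-bound ps y _ e
  ... | false = Relation.Binary.PropositionalEquality.trans (assign-free ps y _ e) e

  closed-assign-negP : ∀ x a p → Closed ([ x ≔ a ] ¬f P p x)
  closed-assign-negP x a p y with y ≡ᵇ x
  ... | true  = refl
  ... | false = refl

-- (R) is the usual two-step renaming: y is not free in [x:=a]φ, so [x:=a]φ may be
-- prefixed by [y:=a], under which the substitution axiom turns [x:=a]φ into φ[y/x];
-- the converse is the same argument for φ[y/x], using φ[y/x][x/y] = φ.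
--
-- (KPI) and (ANI) are both instances of one observation: if a formula ψ is
-- introspective after the assignment x⃗ := a⃗ (ψ → K_x⃗ [x⃗:=a⃗]ψ holds there), then so
-- is its negation. For, by (KNI) the formula ¬K_x⃗[x⃗:=a⃗]ψ is introspective; ¬ψ implies
-- it because K_x⃗[x⃗:=a⃗]ψ → [x⃗:=a⃗]ψ → ψ after x⃗ := a⃗ (re-executing an assignment
-- changes nothing); and [x⃗:=a⃗]¬K_x⃗[x⃗:=a⃗]ψ → [x⃗:=a⃗]¬ψ is the contrapositive of the
-- introspection of ψ, so the knowledge transfers by monotonicity of K.
-- (KPI) takes ψ = ¬K_x⃗ α, introspective by (KNI); (ANI) takes ψ = p_x, by (API).

module Submission where

open import Defs
open import Data.Bool using (Bool; true; false; not; _∧_; _∨_; T)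
open import Data.Bool.Properties using (∨-conicalˡ; ∨-conicalʳ; T-≡; T-∧)
open import Data.Fin using (Fin)
open import Data.Fin.Patterns using (0F; 1F; 2F; 3F)
open import Data.List using (List; []; _∷_; map)
open import Data.List.Properties using (map-cong; map-id; map-id-local; map-∘)
open import Data.List.Relation.Unary.All as All using (All; []; _∷_)
open import Data.List.Relation.Unary.All.Properties using (map⁺)
open import Data.Nat using (ℕ; zero; suc; _≡ᵇ_)
open import Data.Nat.Properties using (_≟_; ≡⇒≡ᵇ)
open import Data.Product using (_×_; _,_; proj₁; proj₂)
open import Data.Vec using (Vec; []; _∷_; lookup) renaming (map to mapᵥ)
open import Data.Vec.Properties using (lookup-map)
open import Function using (_∘_; Equivalence)
open import Relation.Binary.PropositionalEquality
  using (_≡_; _≢_; refl; sym; trans; cong; cong₂) renaming (subst to ≡-subst)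
open import Relation.Nullary using (yes; no)
open import Relation.Nullary.Decidable using (dec-true; dec-false)

≡ᵇ-refl : ∀ m → (m ≡ᵇ m) ≡ true
≡ᵇ-refl m = dec-true (m ≟ m) refl

≢⇒≡ᵇ-false : ∀ {m k} → m ≢ k → (m ≡ᵇ k) ≡ false
≢⇒≡ᵇ-false {m} {k} = dec-false (m ≟ k)

≡ᵇ-false⇒≢ : ∀ {m k} → (m ≡ᵇ k) ≡ false → m ≢ k
≡ᵇ-false⇒≢ {m} {k} e m≡k = ≡-subst T e (≡⇒≡ᵇ m k m≡k)

-- Propositional schemas, so that instances of tautologies can be checked by truth tables.
data Schema (k : ℕ) : Set where
  var  : Fin k → Schema k
  ⊤ₛ   : Schema k
  ¬ₛ_  : Schema k → Schema k
  _∧ₛ_ : Schema k → Schema k → Schema k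

infixr 7 ¬ₛ_
infixr 6 _∧ₛ_
infixr 5 _⇒ₛ_
infix  4 _⇔ₛ_

pattern A = var 0F
pattern B = var 1F
pattern C = var 2F
pattern D = var 3F

⊥ₛ : ∀ {k} → Schema k
⊥ₛ = ¬ₛ ⊤ₛ

_⇒ₛ_ : ∀ {k} → Schema k → Schema k → Schema k
S ⇒ₛ S′ = ¬ₛ (S ∧ₛ ¬ₛ S′)

_⇔ₛ_ : ∀ {k} → Schema k → Schema k → Schema k
S ⇔ₛ S′ = (S ⇒ₛ S′) ∧ₛ (S′ ⇒ₛ S)

⟦_⟧ : ∀ {k} → Schema k → Vec Bool k → Bool
⟦ var i ⟧   ρ = lookup ρ i
⟦ ⊤ₛ ⟧      ρ = true
⟦ ¬ₛ S ⟧    ρ = not (⟦ S ⟧ ρ)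
⟦ S ∧ₛ S′ ⟧ ρ = ⟦ S ⟧ ρ ∧ ⟦ S′ ⟧ ρ

every-row : ∀ k → (Vec Bool k → Bool) → Bool
every-row zero    f = f []
every-row (suc k) f = every-row k (f ∘ (true ∷_)) ∧ every-row k (f ∘ (false ∷_))

every-row-sound : ∀ k f → T (every-row k f) → ∀ ρ → T (f ρ)
every-row-sound zero    f t []         = t
every-row-sound (suc k) f t (true ∷ ρ)  = every-row-sound k _ (proj₁ (Equivalence.to T-∧ t)) ρ
every-row-sound (suc k) f t (false ∷ ρ) = every-row-sound k _ (proj₂ (Equivalence.to T-∧ t)) ρ

module _ (n : ℕ) where
  open Logic n

  instantiate : ∀ {k} → Vec Formula k → Schema k → Formula
  instantiate σ (var i)   = lookup σ i
  instantiate σ ⊤ₛ        = ⊤f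
  instantiate σ (¬ₛ S)    = ¬f instantiate σ S
  instantiate σ (S ∧ₛ S′) = instantiate σ S ∧f instantiate σ S′

  eval-instantiate : ∀ {k} v (σ : Vec Formula k) S →
                     eval v (instantiate σ S) ≡ ⟦ S ⟧ (mapᵥ (eval v) σ)
  eval-instantiate v σ (var i)   = sym (lookup-map i (eval v) σ)
  eval-instantiate v σ ⊤ₛ        = refl
  eval-instantiate v σ (¬ₛ S)    = cong not (eval-instantiate v σ S)
  eval-instantiate v σ (S ∧ₛ S′) = cong₂ _∧_ (eval-instantiate v σ S) (eval-instantiate v σ S′)

  tautology : ∀ {k} (S : Schema k) {_ : T (every-row k ⟦ S ⟧)} (σ : Vec Formula k) →
              ⊢ instantiate σ S
  tautology S {valid} σ = taut λ v →
    trans (eval-instantiate v σ S)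
          (Equivalence.to T-≡ (every-row-sound _ ⟦ S ⟧ valid (mapᵥ (eval v) σ)))

  mp₂ : ∀ {φ ψ χ} → ⊢ (φ ⇒f ψ ⇒f χ) → ⊢ φ → ⊢ ψ → ⊢ χ
  mp₂ ⊢φ⇒ψ⇒χ ⊢φ ⊢ψ = MP (MP ⊢φ⇒ψ⇒χ ⊢φ) ⊢ψ

  ⇒-refl : ∀ φ → ⊢ (φ ⇒f φ)
  ⇒-refl φ = tautology (A ⇒ₛ A) (φ ∷ [])

  syllogism : ∀ φ ψ χ → ⊢ ((φ ⇒f ψ) ⇒f (ψ ⇒f χ) ⇒f (φ ⇒f χ))
  syllogism φ ψ χ = tautology ((A ⇒ₛ B) ⇒ₛ (B ⇒ₛ C) ⇒ₛ (A ⇒ₛ C)) (φ ∷ ψ ∷ χ ∷ [])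

  ⇒-trans : ∀ {φ ψ χ} → ⊢ (φ ⇒f ψ) → ⊢ (ψ ⇒f χ) → ⊢ (φ ⇒f χ)
  ⇒-trans {φ} {ψ} {χ} = mp₂ (syllogism φ ψ χ)

  contraposition : ∀ φ ψ → ⊢ ((φ ⇒f ψ) ⇒f (¬f ψ ⇒f ¬f φ))
  contraposition φ ψ = tautology ((A ⇒ₛ B) ⇒ₛ (¬ₛ B ⇒ₛ ¬ₛ A)) (φ ∷ ψ ∷ [])

  ⇔-elimˡ : ∀ {φ ψ} → ⊢ (φ ⇔f ψ) → ⊢ (φ ⇒f ψ)
  ⇔-elimˡ {φ} {ψ} = MP (tautology ((A ⇔ₛ B) ⇒ₛ (A ⇒ₛ B)) (φ ∷ ψ ∷ []))

  ⇔-elimʳ : ∀ {φ ψ} → ⊢ (φ ⇔f ψ) → ⊢ (ψ ⇒f φ)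
  ⇔-elimʳ {φ} {ψ} = MP (tautology ((A ⇔ₛ B) ⇒ₛ (B ⇒ₛ A)) (φ ∷ ψ ∷ []))

  ⇔-intro : ∀ {φ ψ} → ⊢ (φ ⇒f ψ) → ⊢ (ψ ⇒f φ) → ⊢ (φ ⇔f ψ)
  ⇔-intro {φ} {ψ} = mp₂ (tautology ((A ⇒ₛ B) ⇒ₛ (B ⇒ₛ A) ⇒ₛ (A ⇔ₛ B)) (φ ∷ ψ ∷ []))

  assign-nec : ∀ ps {φ} → ⊢ φ → ⊢ assign ps φ
  assign-nec []             ⊢φ = ⊢φ
  assign-nec ((x , a) ∷ ps) ⊢φ = Gen x a (assign-nec ps ⊢φ)

  assign-dist : ∀ ps φ ψ → ⊢ (assign ps (φ ⇒f ψ) ⇒f assign ps φ ⇒f assign ps ψ)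
  assign-dist []             φ ψ = ⇒-refl (φ ⇒f ψ)
  assign-dist ((x , a) ∷ ps) φ ψ =
    ⇒-trans (MP (Adist x a _ _) (Gen x a (assign-dist ps φ ψ)))
            (Adist x a (assign ps φ) (assign ps ψ))

  assign-mono : ∀ ps {φ ψ} → ⊢ (φ ⇒f ψ) → ⊢ (assign ps φ ⇒f assign ps ψ)
  assign-mono ps {φ} {ψ} ⊢φ⇒ψ = MP (assign-dist ps φ ψ) (assign-nec ps ⊢φ⇒ψ)

  assign-lift : ∀ ps {φ ψ} → ⊢ (φ ⇒f ψ) → ⊢ assign ps φ → ⊢ assign ps ψ
  assign-lift ps ⊢φ⇒ψ = MP (assign-mono ps ⊢φ⇒ψ)

  assign-lift₂ : ∀ ps {φ ψ χ} → ⊢ (φ ⇒f ψ ⇒f χ) →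
                 ⊢ assign ps φ → ⊢ assign ps ψ → ⊢ assign ps χ
  assign-lift₂ ps {φ} {ψ} {χ} ⊢φ⇒ψ⇒χ ⊢φ =
    MP (MP (assign-dist ps ψ χ) (assign-lift ps ⊢φ⇒ψ⇒χ ⊢φ))

  assign-⇒-trans : ∀ ps {φ ψ χ} → ⊢ assign ps (φ ⇒f ψ) → ⊢ assign ps (ψ ⇒f χ) →
                   ⊢ assign ps (φ ⇒f χ)
  assign-⇒-trans ps {φ} {ψ} {χ} = assign-lift₂ ps (syllogism φ ψ χ)

  assign-vacuous : ∀ ps θ → Closed θ → ⊢ (θ ⇒f assign ps θ)
  assign-vacuous []             θ cθ = ⇒-refl θ
  assign-vacuous ((x , a) ∷ ps) θ cθ =
    ⇒-trans (Avac x a θ (cθ x)) (assign-mono ((x , a) ∷ []) (assign-vacuous ps θ cθ))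

  assign-comm : ∀ x a ps θ → memb x (vars ps) ≡ false →
                ⊢ (assign ps ([ x ≔ a ] θ) ⇒f [ x ≔ a ] assign ps θ)
  assign-comm x a []             θ x∉ps = ⇒-refl ([ x ≔ a ] θ)
  assign-comm x a ((y , b) ∷ ps) θ x∉ps with x ≡ᵇ y in x≢ᵇy
  assign-comm x a ((y , b) ∷ ps) θ () | true
  ... | false =
    ⇒-trans (assign-mono ((y , b) ∷ []) (assign-comm x a ps θ x∉ps))
            (Acomm y x b a (assign ps θ) (≡ᵇ-false⇒≢ x≢ᵇy ∘ sym))

  assign-bound : ∀ ps y χ → memb y (vars ps) ≡ true → isFree y (assign ps χ) ≡ false
  assign-bound []             y χ ()
  assign-bound ((z , a) ∷ ps) y χ y∈ps with y ≡ᵇ z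
  ... | true  = refl
  ... | false = assign-bound ps y χ y∈ps

  assign-unbound : ∀ ps y χ → memb y (vars ps) ≡ false → isFree y (assign ps χ) ≡ isFree y χ
  assign-unbound []             y χ y∉ps = refl
  assign-unbound ((z , a) ∷ ps) y χ y∉ps with y ≡ᵇ z
  assign-unbound ((z , a) ∷ ps) y χ () | true
  ... | false = assign-unbound ps y χ y∉ps

  closed-assign : ∀ ps χ → (∀ y → memb y (vars ps) ≡ false → isFree y χ ≡ false) →
                  Closed (assign ps χ)
  closed-assign ps χ FV⊆ps y with memb y (vars ps) in e
  ... | true  = assign-bound ps y χ e
  ... | false = trans (assign-unbound ps y χ e) (FV⊆ps y e)

  closed-assign-P : ∀ x a p → Closed ([ x ≔ a ] P p x)
  closed-assign-P x a p y with y ≡ᵇ x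
  ... | true  = refl
  ... | false = refl

  K-mono : ∀ X α β (cα : Closed α) (cβ : Closed β) → ⊢ (α ⇒f β) → ⊢ (𝐊 X α cα ⇒f 𝐊 X β cβ)
  K-mono X α β cα cβ ⊢α⇒β =
    MP (Kdist X α β cα cβ cα⇒β) (MP (Kmono [] X (α ⇒f β) cα⇒β (λ ())) (Nec cα⇒β ⊢α⇒β))
    where
      cα⇒β : Closed (α ⇒f β)
      cα⇒β y = cong₂ _∨_ (cα y) (cβ y)

  rn-self : ∀ x z → rn x x z ≡ z
  rn-self x z with z ≟ x
  ... | yes refl rewrite ≡ᵇ-refl z = refl
  ... | no z≢x   rewrite ≢⇒≡ᵇ-false z≢x = refl

  subst-self : ∀ x φ → subst x x φ ≡ φ
  subst-self x (P p z)       = cong (P p) (rn-self x z)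
  subst-self x ⊤f            = refl
  subst-self x (¬f φ)        = cong ¬f_ (subst-self x φ)
  subst-self x (φ ∧f ψ)      = cong₂ _∧f_ (subst-self x φ) (subst-self x ψ)
  subst-self x ([ z ≔ a ] φ) with z ≡ᵇ x
  ... | true  = refl
  ... | false = cong ([ z ≔ a ]_) (subst-self x φ)
  subst-self x (𝐊 X α c)     = cong (λ Y → 𝐊 Y α c) (trans (map-cong (rn-self x) X) (map-id X))

  admissible-self : ∀ x φ → admissible x x φ ≡ true
  admissible-self x (P p z)       = refl
  admissible-self x ⊤f            = refl
  admissible-self x (¬f φ)        = admissible-self x φ
  admissible-self x (φ ∧f ψ)      = cong₂ _∧_ (admissible-self x φ) (admissible-self x ψ)
  admissible-self x ([ z ≔ a ] φ) with z ≡ᵇ x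
  ... | true  = refl
  ... | false = admissible-self x φ
  admissible-self x (𝐊 X α c)     = refl

  reassign₁ : ∀ x a φ → ⊢ ([ x ≔ a ] ([ x ≔ a ] φ ⇒f φ))
  reassign₁ x a φ =
    ≡-subst (λ φ′ → ⊢ ([ x ≔ a ] ([ x ≔ a ] φ ⇒f φ′))) (subst-self x φ)
            (Asub x x a φ (admissible-self x φ))

  executable : ∀ x a → ⊢ ([ x ≔ a ] ⟨ x ≔ a ⟩ ⊤f)
  executable x a =
    assign-lift ((x , a) ∷ []) (tautology ((A ⇒ₛ ⊥ₛ) ⇒ₛ ¬ₛ A) ([ x ≔ a ] ⊥f ∷ []))
                (reassign₁ x a ⊥f)

  closed-executable : ∀ x a → Closed (⟨ x ≔ a ⟩ ⊤f)
  closed-executable x a = closed-assign ((x , a) ∷ []) ⊥f (λ _ _ → refl)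

  -- If [x:=a]χ and ¬χ held, the latter would persist as [x:=a]¬χ, giving [x:=a]⊥.
  unassign : ∀ x a χ → isFree x χ ≡ false → ⊢ (⟨ x ≔ a ⟩ ⊤f ⇒f [ x ≔ a ] χ ⇒f χ)
  unassign x a χ x∉χ =
    mp₂ (tautology ((¬ₛ A ⇒ₛ B) ⇒ₛ (C ⇒ₛ B ⇒ₛ D) ⇒ₛ (¬ₛ D ⇒ₛ C ⇒ₛ A))
                   (χ ∷ [ x ≔ a ] ¬f χ ∷ [ x ≔ a ] χ ∷ [ x ≔ a ] ⊥f ∷ []))
        (Avac x a (¬f χ) x∉χ)
        (⇒-trans (assign-mono ((x , a) ∷ []) (tautology (A ⇒ₛ ¬ₛ A ⇒ₛ ⊥ₛ) (χ ∷ [])))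
                 (Adist x a (¬f χ) ⊥f))

  -- If x recurs in ps it is not free in [ps]φ, so the outer [x:=a] is vacuous
  -- (assignments being executable); otherwise [x:=a] commutes past ps.
  reassign-head : ∀ x a ps φ →
                  ⊢ ([ x ≔ a ] assign ps ([ x ≔ a ] assign ps φ ⇒f assign ps φ))
  reassign-head x a ps φ with memb x (vars ps) in x∈ps
  ... | true  =
    assign-lift ((x , a) ∷ ps) (unassign x a (assign ps φ) (assign-bound ps x φ x∈ps))
      (assign-lift ((x , a) ∷ []) (assign-vacuous ps _ (closed-executable x a)) (executable x a))
  ... | false =
    MP (assign-comm x a ps _ x∈ps) (assign-nec ps (reassign₁ x a (assign ps φ)))

  reassign : ∀ ps φ → ⊢ assign ps (assign ps φ ⇒f φ)
  reassign []             φ = ⇒-refl φ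
  reassign ((x , a) ∷ ps) φ =
    assign-⇒-trans ((x , a) ∷ ps) (reassign-head x a ps φ) (Gen x a (reassign ps φ))

  Introspective : ∀ ps ψ → Closed (assign ps ψ) → Set
  Introspective ps ψ c = ⊢ assign ps (ψ ⇒f 𝐊 (vars ps) (assign ps ψ) c)

  closed-assign-¬𝐊 : ∀ ps α (cα : Closed α) → Closed (assign ps (¬f 𝐊 (vars ps) α cα))
  closed-assign-¬𝐊 ps α cα = closed-assign ps _ (λ _ y∉ps → y∉ps)

  introspective-complement : ∀ ps ψ χ (cψ : Closed (assign ps ψ)) (cχ : Closed (assign ps χ)) →
                             ⊢ (χ ⇔f ¬f ψ) → Introspective ps ψ cψ → Introspective ps χ cχ
  introspective-complement ps ψ χ cψ cχ χ⇔¬ψ ψ-introspective =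
    assign-⇒-trans ps χ⇒¬Kθ
      (assign-⇒-trans ps (KNI ps θ cψ cδ) (assign-nec ps Kδ⇒K[ps]χ))
    where
      X : List Var
      X = vars ps
      θ Kθ δ : Formula
      θ  = assign ps ψ
      Kθ = 𝐊 X θ cψ
      δ  = assign ps (¬f Kθ)
      cδ : Closed δ
      cδ = closed-assign-¬𝐊 ps θ cψ

      χ⇒¬Kθ : ⊢ assign ps (χ ⇒f ¬f Kθ)
      χ⇒¬Kθ =
        assign-⇒-trans ps (assign-nec ps (⇔-elimˡ χ⇔¬ψ))
          (assign-lift ps (contraposition Kθ ψ)
            (assign-⇒-trans ps (assign-nec ps (KT X θ cψ)) (reassign ps ψ)))

      δ⇒[ps]χ : ⊢ (δ ⇒f assign ps χ)
      δ⇒[ps]χ =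
        MP (assign-dist ps (¬f Kθ) χ)
           (assign-⇒-trans ps (assign-lift ps (contraposition ψ Kθ) ψ-introspective)
                              (assign-nec ps (⇔-elimʳ χ⇔¬ψ)))

      Kδ⇒K[ps]χ : ⊢ (𝐊 X δ cδ ⇒f 𝐊 X (assign ps χ) cχ)
      Kδ⇒K[ps]χ = K-mono X δ (assign ps χ) cδ cχ δ⇒[ps]χ

  positive-introspection : ∀ ps α (cα : Closed α) →
                           Introspective ps (𝐊 (vars ps) α cα) (closed-assign-K ps α cα)
  positive-introspection ps α cα =
    introspective-complement ps _ _ (closed-assign-¬𝐊 ps α cα) (closed-assign-K ps α cα)
      (tautology (A ⇔ₛ ¬ₛ ¬ₛ A) (𝐊 (vars ps) α cα ∷ []))
      (KNI ps α cα (closed-assign-¬𝐊 ps α cα))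

  negative-atom-introspection : ∀ x a p →
                                Introspective ((x , a) ∷ []) (¬f P p x) (closed-assign-negP x a p)
  negative-atom-introspection x a p =
    introspective-complement ((x , a) ∷ []) _ _ (closed-assign-P x a p) (closed-assign-negP x a p)
      (tautology (A ⇔ₛ A) (¬f P p x ∷ []))
      (API x a p (closed-assign-P x a p))

  -- y does not occur in φ, except possibly inside the sentences under 𝐊,
  -- which substitution never enters.
  data Fresh (y : Var) : Formula → Set where
    fresh-P : ∀ {p z} → y ≢ z → Fresh y (P p z)
    fresh-⊤ : Fresh y ⊤f
    fresh-¬ : ∀ {φ} → Fresh y φ → Fresh y (¬f φ)
    fresh-∧ : ∀ {φ ψ} → Fresh y φ → Fresh y ψ → Fresh y (φ ∧f ψ)
    fresh-≔ : ∀ {z a φ} → y ≢ z → Fresh y φ → Fresh y ([ z ≔ a ] φ)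
    fresh-𝐊 : ∀ {X α} .{c : Closed α} → All (y ≢_) X → Fresh y (𝐊 X α c)

  not-memb⇒All≢ : ∀ {y} X → memb y X ≡ false → All (y ≢_) X
  not-memb⇒All≢ []      _    = []
  not-memb⇒All≢ {y} (z ∷ X) y∉X with y ≡ᵇ z in y≢ᵇz
  ... | false = ≡ᵇ-false⇒≢ y≢ᵇz ∷ not-memb⇒All≢ X y∉X

  All≢⇒not-memb : ∀ {y X} → All (y ≢_) X → memb y X ≡ false
  All≢⇒not-memb []            = refl
  All≢⇒not-memb (y≢z ∷ y∉X) rewrite ≢⇒≡ᵇ-false y≢z = All≢⇒not-memb y∉X

  fresh : ∀ {y} φ → occurs y φ ≡ false → Fresh y φ
  fresh (P p z)       o = fresh-P (≡ᵇ-false⇒≢ o)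
  fresh ⊤f            o = fresh-⊤
  fresh (¬f φ)        o = fresh-¬ (fresh φ o)
  fresh (φ ∧f ψ)      o = fresh-∧ (fresh φ (∨-conicalˡ _ _ o)) (fresh ψ (∨-conicalʳ _ _ o))
  fresh ([ z ≔ a ] φ) o = fresh-≔ (≡ᵇ-false⇒≢ (∨-conicalˡ _ _ o)) (fresh φ (∨-conicalʳ _ _ o))
  fresh (𝐊 X α c)     o = fresh-𝐊 {c = c} (not-memb⇒All≢ X (∨-conicalˡ _ _ o))

  fresh⇒not-free : ∀ {y φ} → Fresh y φ → isFree y φ ≡ false
  fresh⇒not-free (fresh-P y≢z)     = ≢⇒≡ᵇ-false y≢z
  fresh⇒not-free fresh-⊤           = refl
  fresh⇒not-free (fresh-¬ y♯φ)     = fresh⇒not-free y♯φ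
  fresh⇒not-free (fresh-∧ y♯φ y♯ψ) = cong₂ _∨_ (fresh⇒not-free y♯φ) (fresh⇒not-free y♯ψ)
  fresh⇒not-free (fresh-≔ y≢z y♯φ) rewrite ≢⇒≡ᵇ-false y≢z = fresh⇒not-free y♯φ
  fresh⇒not-free (fresh-𝐊 y∉X)     = All≢⇒not-memb y∉X

  not-free-≔ : ∀ {y} x a φ → isFree y φ ≡ false → isFree y ([ x ≔ a ] φ) ≡ false
  not-free-≔ {y} x a φ y∉φ with y ≡ᵇ x
  ... | true  = refl
  ... | false = y∉φ

  fresh⇒admissible : ∀ {y φ} x → Fresh y φ → admissible y x φ ≡ true
  fresh⇒admissible x (fresh-P y≢z)     = refl
  fresh⇒admissible x fresh-⊤           = refl
  fresh⇒admissible x (fresh-¬ y♯φ)     = fresh⇒admissible x y♯φ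
  fresh⇒admissible x (fresh-∧ y♯φ y♯ψ) =
    cong₂ _∧_ (fresh⇒admissible x y♯φ) (fresh⇒admissible x y♯ψ)
  fresh⇒admissible x (fresh-≔ {z} y≢z y♯φ) with z ≡ᵇ x
  ... | true  = refl
  ... | false rewrite ≢⇒≡ᵇ-false (y≢z ∘ sym) = fresh⇒admissible x y♯φ
  fresh⇒admissible x (fresh-𝐊 y∉X)     = refl

  rn-fresh : ∀ {x y z} → y ≢ z → rn x y z ≡ z
  rn-fresh y≢z rewrite ≢⇒≡ᵇ-false (y≢z ∘ sym) = refl

  rn-inverse : ∀ {x y z} → y ≢ z → rn x y (rn y x z) ≡ z
  rn-inverse {x} {y} {z} y≢z with z ≟ x
  ... | yes refl rewrite ≡ᵇ-refl z | ≡ᵇ-refl y = refl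
  ... | no z≢x   rewrite ≢⇒≡ᵇ-false z≢x = rn-fresh y≢z

  rn-eliminates : ∀ {x y} z → x ≢ y → x ≢ rn y x z
  rn-eliminates {x} z x≢y with z ≟ x
  ... | yes refl rewrite ≡ᵇ-refl z = x≢y
  ... | no z≢x   rewrite ≢⇒≡ᵇ-false z≢x = z≢x ∘ sym

  subst-fresh : ∀ {x y φ} → Fresh y φ → subst x y φ ≡ φ
  subst-fresh (fresh-P y≢z)     = cong (P _) (rn-fresh y≢z)
  subst-fresh fresh-⊤           = refl
  subst-fresh (fresh-¬ y♯φ)     = cong ¬f_ (subst-fresh y♯φ)
  subst-fresh (fresh-∧ y♯φ y♯ψ) = cong₂ _∧f_ (subst-fresh y♯φ) (subst-fresh y♯ψ)
  subst-fresh (fresh-≔ {z} {a} y≢z y♯φ) rewrite ≢⇒≡ᵇ-false (y≢z ∘ sym) =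
    cong ([ z ≔ a ]_) (subst-fresh y♯φ)
  subst-fresh (fresh-𝐊 {α = α} {c} y∉X) =
    cong (λ Y → 𝐊 Y α c) (map-id-local (All.map rn-fresh y∉X))

  subst-inverse : ∀ {x y φ} → Fresh y φ → subst x y (subst y x φ) ≡ φ
  subst-inverse (fresh-P y≢z)     = cong (P _) (rn-inverse y≢z)
  subst-inverse fresh-⊤           = refl
  subst-inverse (fresh-¬ y♯φ)     = cong ¬f_ (subst-inverse y♯φ)
  subst-inverse (fresh-∧ y♯φ y♯ψ) = cong₂ _∧f_ (subst-inverse y♯φ) (subst-inverse y♯ψ)
  subst-inverse {x} (fresh-≔ {z} {a} y≢z y♯φ) with z ≡ᵇ x
  ... | true  rewrite ≢⇒≡ᵇ-false (y≢z ∘ sym) = cong ([ z ≔ a ]_) (subst-fresh y♯φ)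
  ... | false rewrite ≢⇒≡ᵇ-false (y≢z ∘ sym) = cong ([ z ≔ a ]_) (subst-inverse y♯φ)
  subst-inverse (fresh-𝐊 {X} {α} {c} y∉X) =
    cong (λ Y → 𝐊 Y α c) (trans (sym (map-∘ X)) (map-id-local (All.map rn-inverse y∉X)))

  subst-admissible : ∀ {x y φ} → Fresh y φ → admissible x y (subst y x φ) ≡ true
  subst-admissible (fresh-P y≢z)     = refl
  subst-admissible fresh-⊤           = refl
  subst-admissible (fresh-¬ y♯φ)     = subst-admissible y♯φ
  subst-admissible (fresh-∧ y♯φ y♯ψ) = cong₂ _∧_ (subst-admissible y♯φ) (subst-admissible y♯ψ)
  subst-admissible {x} (fresh-≔ {z} y≢z y♯φ) with z ≡ᵇ x in z≡ᵇx
  ... | true  rewrite ≢⇒≡ᵇ-false (y≢z ∘ sym) | z≡ᵇx | fresh⇒not-free y♯φ = refl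
  ... | false rewrite ≢⇒≡ᵇ-false (y≢z ∘ sym) | z≡ᵇx = subst-admissible y♯φ
  subst-admissible (fresh-𝐊 y∉X)     = refl

  subst-eliminates : ∀ {x y} φ → x ≢ y → isFree x (subst y x φ) ≡ false
  subst-eliminates (P p z)           x≢y = ≢⇒≡ᵇ-false (rn-eliminates z x≢y)
  subst-eliminates ⊤f                x≢y = refl
  subst-eliminates (¬f φ)            x≢y = subst-eliminates φ x≢y
  subst-eliminates (φ ∧f ψ)          x≢y =
    cong₂ _∨_ (subst-eliminates φ x≢y) (subst-eliminates ψ x≢y)
  subst-eliminates {x} ([ z ≔ a ] φ) x≢y with z ≟ x
  ... | yes refl rewrite ≡ᵇ-refl z | ≡ᵇ-refl z = refl
  ... | no z≢x   rewrite ≢⇒≡ᵇ-false z≢x | ≢⇒≡ᵇ-false (z≢x ∘ sym) = subst-eliminates φ x≢y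
  subst-eliminates (𝐊 X α c)         x≢y =
    All≢⇒not-memb (map⁺ (All.tabulate {xs = X} λ {z} _ → rn-eliminates z x≢y))

  renamed-not-free : ∀ x y a φ → isFree x ([ y ≔ a ] subst y x φ) ≡ false
  renamed-not-free x y a φ with x ≟ y
  ... | yes refl rewrite ≡ᵇ-refl x = refl
  ... | no x≢y   rewrite ≢⇒≡ᵇ-false x≢y = subst-eliminates φ x≢y

  assign-rename : ∀ x y a φ → isFree y ([ x ≔ a ] φ) ≡ false → admissible y x φ ≡ true →
                  ⊢ ([ x ≔ a ] φ ⇒f [ y ≔ a ] subst y x φ)
  assign-rename x y a φ y∉[x≔a]φ admissible-y/x =
    ⇒-trans (Avac y a ([ x ≔ a ] φ) y∉[x≔a]φ) (MP (Adist y a _ _) (Asub x y a φ admissible-y/x))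

  alpha-renaming : ∀ x y a φ → Fresh y φ → ⊢ ([ x ≔ a ] φ ⇔f [ y ≔ a ] subst y x φ)
  alpha-renaming x y a φ y♯φ = ⇔-intro
    (assign-rename x y a φ (not-free-≔ x a φ (fresh⇒not-free y♯φ)) (fresh⇒admissible x y♯φ))
    (≡-subst (λ φ′ → ⊢ ([ y ≔ a ] subst y x φ ⇒f [ x ≔ a ] φ′)) (subst-inverse y♯φ)
       (assign-rename y x a (subst y x φ) (renamed-not-free x y a φ) (subst-admissible y♯φ)))

mainTheorem7 : (n : ℕ) → let open Logic n in
    (∀ (x y : Var) (a : Agent) (φ : Formula) → occurs y φ ≡ false →
       ⊢ ([ x ≔ a ] φ ⇔f [ y ≔ a ] subst y x φ))
    × (∀ (ps : List (Var × Agent)) (α : Formula) (cα : Closed α) →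
       ⊢ assign ps (𝐊 (vars ps) α cα ⇒f
                     𝐊 (vars ps) (assign ps (𝐊 (vars ps) α cα)) (closed-assign-K ps α cα)))
    × (∀ (x : Var) (a : Agent) (p : Pred) →
       ⊢ ([ x ≔ a ] (¬f P p x ⇒f 𝐊 (x ∷ []) ([ x ≔ a ] ¬f P p x) (closed-assign-negP x a p))))
mainTheorem7 n =
    (λ x y a φ y∉φ → alpha-renaming n x y a φ (fresh n φ y∉φ))
  , positive-introspection n
  , negative-atom-introspection n
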